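{- Suppose $A$ and $X$ are countable. Then every set in the Borel $\sigma$-algebra $\Sigma_{\mathrm{Path}(X)}$ of the Alexandroff topology on $\mathrm{Path}(X)$ belongs to the Borel $\sigma$-algebra $\Sigma_{\mathrm{Path}(X)^\infty}$ generated by the Scott-open subsets of $\mathrm{Path}(X)^\infty$. Likewise $\Sigma_{\mathrm{Path}_\sim(X)}\subseteq\Sigma_{\mathrm{Path}_\sim(X)^\infty}$.
   Context: Fix a set $A$, $\tau\notin A$, $A_\tau=A\cup\{\tau\}$, $A_\tau^*$ finite words, $\epsilon$ the empty word, ${\downarrow}\sigma$ the set of prefixes of $\sigma$. A path on $X$ is a function $p$ into $X$ with domain ${\downarrow}\sigma$ for some $\sigma\in A_\tau^*$; $\mathrm{Path}(X)$ is ordered by $p\preceq q$ iff $\mathrm{dom}\,p\subseteq\mathrm{dom}\,q$ and $q$ agrees with $p$ on $\mathrm{dom}\,p$. The stutter basis of $p$ is the unique $\phi:\mathrm{dom}\,p\to A_\tau^*$ with $\phi(\epsilon)=\epsilon$; $\phi(\sigma'\tau)=\phi(\sigma')$ if $p(\sigma'\tau)=p(\sigma')$; $\phi(\sigma'\tau)=\phi(\sigma')\tau$ otherwise; $\phi(\sigma'a)=\phi(\sigma')a$ for $a\in A$; $\mathrm{st}(p)$ is the path with domain $\phi(\mathrm{dom}\,p)$ and $\mathrm{st}(p)\circ\phi=p$; $p\sim q$ iff $\mathrm{st}(p)=\mathrm{st}(q)$; $\mathrm{Path}_\sim(X)$ is the quotient ordered by $[p]\preceq[q]$ iff $\mathrm{st}(p)\preceq\mathrm{st}(q)$.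 Both are prefix orders. For a prefix order $Y$ with Alexandroff topology (open = upward closed), a subset $C$ is non-sober if it is downward closed, irreducible (nonempty and not a union of two smaller downward closed sets) and not of the form ${\downarrow}y$; $Y^\infty=Y\cup\{\infty_C\mid C\text{ non-sober}\}$ with order extending that of $Y$ by $\infty_C\preceq\infty_C$ and $y\preceq\infty_C$ for $y\in C$. Scott-open subsets of $Y^\infty$: upward closed $U$ such that every directed set whose supremum exists and lies in $U$ meets $U$. -}

module Defs where

open import Level using (Level; _⊔_) renaming (suc to lsuc; zero to lzero)
open import Data.Nat using (ℕ)
open import Data.Maybe using (Maybe; just; nothing)
open import Data.List using (List; []; _∷_)
open import Data.Product using (Σ; ∃; _×_; _,_; proj₁; proj₂)
open import Data.Sum using (_⊎_; inj₁; inj₂)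
open import Data.Empty using (⊥)
open import Data.Unit using (⊤)
open import Relation.Nullary using (¬_)
open import Relation.Binary.PropositionalEquality using (_≡_; _≢_)
open import Function.Definitions using (Injective)

-- Countability: an injection into ℕ (covers finite and empty sets)

Countable : Set → Set
Countable T = Σ (T → ℕ) λ f → Injective _≡_ _≡_ f

_⇔_ : Set → Set → Set
P ⇔ Q = (P → Q) × (Q → P)

module Order {Y : Set} (_≼_ : Y → Y → Set) where

  Subset : Set₁
  Subset = Y → Set

  _⊆_ : Subset → Subset → Set
  C ⊆ D = ∀ y → C y → D y

  UpClosed : Subset → Set
  UpClosed U = ∀ {x y} → x ≼ y → U x → U y

  DownClosed : Subset → Set
  DownClosed C = ∀ {x y} → y ≼ x → C x → C y

  _⊂_ : Subset → Subset → Set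
  C₁ ⊂ C = C₁ ⊆ C × ¬ (C ⊆ C₁)

  Irreducible : Subset → Set₁
  Irreducible C =
    (∃ λ y → C y) ×
    ¬ (Σ Subset λ C₁ → Σ Subset λ C₂ →
         DownClosed C₁ × DownClosed C₂ × C₁ ⊂ C × C₂ ⊂ C ×
         (∀ y → C y ⇔ (C₁ y ⊎ C₂ y)))

  Principal : Subset → Set
  Principal C = ∃ λ y → ∀ z → C z ⇔ (z ≼ y)

  NonSober : Subset → Set₁
  NonSober C = DownClosed C × Irreducible C × ¬ Principal C

  Y∞ : Set₁
  Y∞ = Y ⊎ Σ Subset NonSober

  _≼∞_ : Y∞ → Y∞ → Set
  inj₁ x ≼∞ inj₁ y = x ≼ y
  inj₁ x ≼∞ inj₂ (C , _) = C x
  inj₂ _ ≼∞ inj₁ _ = ⊥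
  inj₂ (C , _) ≼∞ inj₂ (D , _) = ∀ z → C z ⇔ D z

  Subset∞ : Set₁
  Subset∞ = Y∞ → Set

  Directed : Subset∞ → Set₁
  Directed D = (∃ λ d → D d) ×
    (∀ a b → D a → D b → ∃ λ c → D c × a ≼∞ c × b ≼∞ c)

  IsSup : Subset∞ → Y∞ → Set₁
  IsSup D s = (∀ d → D d → d ≼∞ s) ×
              (∀ u → (∀ d → D d → d ≼∞ u) → s ≼∞ u)

  AlexOpen : Subset → Set
  AlexOpen = UpClosed

  ScottOpen : Subset∞ → Set₁
  ScottOpen U =
    (∀ {x y} → x ≼∞ y → U x → U y) ×
    (∀ D → Directed D → ∀ s → IsSup D s → U s → ∃ λ d → D d × U d)

  embed : Subset → Subset∞
  embed S (inj₁ y) = S y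
  embed S (inj₂ _) = ⊥

-- σ-algebra generated by a family G of subsets of Z
-- (subsets are predicates; sets with the same elements are identified
-- via the 'ext' rule)

data SigmaGen {ℓz ℓg : Level} {Z : Set ℓz} (G : (Z → Set) → Set ℓg)
     : (Z → Set) → Set (ℓz ⊔ lsuc lzero ⊔ ℓg) where
  gen   : ∀ {S} → G S → SigmaGen G S
  whole : SigmaGen G (λ _ → ⊤)
  compl : ∀ {S} → SigmaGen G S → SigmaGen G (λ z → ¬ S z)
  union : (F : ℕ → Z → Set) → (∀ n → SigmaGen G (F n)) →
          SigmaGen G (λ z → Σ ℕ λ n → F n z)
  ext   : ∀ {S T} → SigmaGen G S → (∀ z → S z ⇔ T z) → SigmaGen G T

-- Paths.  A_τ = Maybe A, with nothing playing the role of τ.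
-- A path p with domain ↓σ, σ = a₁…aₙ, is recorded as its start value
-- p(ε) together with the list of steps (aᵢ , p(a₁…aᵢ)).

module _ (A X : Set) where

  Aτ : Set
  Aτ = Maybe A

  Word : Set
  Word = List Aτ

  record Path : Set where
    constructor mkPath
    field
      start : X
      steps : List (Aτ × X)

  -- AtS x s ρ v : ρ lies in the domain and the path takes value v at ρ
  data AtS : X → List (Aτ × X) → Word → X → Set where
    here : ∀ {x s} → AtS x s [] x
    step : ∀ {x a y s ρ v} → AtS y s ρ v → AtS x ((a , y) ∷ s) (a ∷ ρ) v

  At : Path → Word → X → Set
  At p = AtS (Path.start p) (Path.steps p)

  -- p ⪯ q iff dom p ⊆ dom q and q agrees with p on dom p
  _⪯_ : Path → Path → Set
  p ⪯ q = ∀ ρ v → At p ρ v → At q ρ v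

  -- StS x s s' : the stutter-removal (via the stutter basis φ) of the
  -- path with start x and steps s has steps s'
  data StS : X → List (Aτ × X) → List (Aτ × X) → Set where
    nil  : ∀ {x} → StS x [] []
    vis  : ∀ {x a y s s'} → StS y s s' →
           StS x ((just a , y) ∷ s) ((just a , y) ∷ s')
    stut : ∀ {x s s'} → StS x s s' → StS x ((nothing , x) ∷ s) s'
    tau  : ∀ {x y s s'} → y ≢ x → StS y s s' →
           StS x ((nothing , y) ∷ s) ((nothing , y) ∷ s')

  St : Path → Path → Set
  St p q = (Path.start q ≡ Path.start p) × StS (Path.start p) (Path.steps p) (Path.steps q)

  -- order of Path_∼(X), represented on representatives: [p] ⪯ [q] iff st(p) ⪯ st(q)
  _⪯∼_ : Path → Path → Set
  p ⪯∼ q = ∀ p' q' → St p p' → St q q' → p' ⪯ q'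

BorelInclusion : {Y : Set} → (Y → Y → Set) → Set₁
BorelInclusion _≼_ =
  ∀ S → SigmaGen AlexOpen S → SigmaGen ScottOpen (embed S)
  where open Order _≼_

-- The argument works for any preorder Y whose carrier is countable,
-- classically.  Its core is that for each y the complement of ↓y in Y^∞ is
-- Scott-open: it is upward closed, and if a directed set D lay entirely
-- inside ↓y then y would be an upper bound of D, so every supremum of D
-- would lie in ↓y.  Hence each principal downset ↓y ⊆ Y is Scott-Borel.
-- An upward closed S ⊆ Y is Y minus the union of the ↓w with w ∉ S, and Y
-- itself is the union of all ↓y; both unions are countable because Y is.
-- Induction on the generation of Σ_Y then transports complements, unions
-- and extensional rewriting into Σ_{Y^∞}.

module Submission where

open import Defs
open import Level using (0ℓ)
open import Data.Product using (_×_; Σ; ∃; _,_; proj₁; proj₂)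
open import Axiom.ExcludedMiddle using (ExcludedMiddle)
open import Data.Sum using (inj₁; inj₂)
open import Data.Empty using (⊥; ⊥-elim)
open import Data.Unit using (⊤; tt)
open import Data.Nat using (ℕ; zero; suc)
open import Data.Nat.Properties using (suc-injective; _≟_)
open import Data.Nat.Binary using (ℕᵇ; 2[1+_]; 1+[2_]) renaming (zero to 0ᵇ; toℕ to toℕᵇ)
open import Data.Nat.Binary.Properties using (toℕ-injective; 2[1+_]-injective; 1+[2_]-injective)
open import Data.Maybe using (Maybe; just; nothing)
open import Data.List using (List; []; _∷_)
open import Data.List.Properties using (∷-injective)
open import Relation.Nullary using (¬_; yes; no; Dec)
open import Relation.Nullary.Decidable using (decidable-stable; map′)
open import Relation.Binary.PropositionalEquality using (_≡_; refl; sym; trans; cong; cong₂; subst)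
open import Function.Definitions using (Injective)

dne : ExcludedMiddle 0ℓ → {P : Set} → ¬ ¬ P → P
dne em = decidable-stable em

module SigmaAlgebra {ℓz ℓg} {Z : Set ℓz} (G : (Z → Set) → Set ℓg)
                    (em : ExcludedMiddle 0ℓ) where

  Σ-empty : SigmaGen G (λ _ → ⊥)
  Σ-empty = ext (compl whole) (λ _ → (λ ¬⊤ → ¬⊤ tt) , λ ())

  Σ-∩ : ∀ {S T} → SigmaGen G S → SigmaGen G T → SigmaGen G (λ z → S z × T z)
  Σ-∩ {S} {T} gS gT = ext (compl (union F gF)) de-Morgan
    where
    F : ℕ → Z → Set
    F zero    z = ¬ S z
    F (suc _) z = ¬ T z
    gF : ∀ n → SigmaGen G (F n)
    gF zero    = compl gS
    gF (suc _) = compl gT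
    de-Morgan : ∀ z → (¬ Σ ℕ λ n → F n z) ⇔ (S z × T z)
    de-Morgan z =
        (λ none → dne em (λ ¬s → none (0 , ¬s)) , dne em (λ ¬t → none (1 , ¬t)))
      , λ { (s , t) (zero , ¬s) → ¬s s ; (s , t) (suc _ , ¬t) → ¬t t }

  -- Union of a family indexed by the members of a subset P of a countable
  -- index set: the n-th member of the ℕ-indexed union is the set whose
  -- index is coded by n (or ∅ if n codes no index in P).
  Σ-⋃ : {I : Set} → Countable I → (P : I → Set) (E : I → Z → Set) →
        (∀ i → SigmaGen G (E i)) → SigmaGen G (λ z → Σ I λ i → P i × E i z)
  Σ-⋃ {I} (code , code-inj) P E gE = ext (union F gF) reindex
    where
    F : ℕ → Z → Set
    F n z = Σ I λ i → code i ≡ n × P i × E i z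
    gF : ∀ n → SigmaGen G (F n)
    gF n with em {Σ I λ i → code i ≡ n × P i}
    ... | yes (i , cᵢ , pᵢ) =
      ext (gE i) λ z → (λ e → i , cᵢ , pᵢ , e)
                     , λ { (j , cⱼ , _ , e) → subst (λ k → E k z) (code-inj (trans cⱼ (sym cᵢ))) e }
    ... | no none = ext Σ-empty λ z → (λ ()) , λ { (j , cⱼ , pⱼ , _) → none (j , cⱼ , pⱼ) }
    reindex : ∀ z → (Σ ℕ λ n → F n z) ⇔ (Σ I λ i → P i × E i z)
    reindex z = (λ { (_ , i , _ , p , e) → i , p , e }) , λ { (i , p , e) → code i , i , refl , p , e }

module CountablePreorder {Y : Set} (_≼_ : Y → Y → Set)
  (≼-refl : ∀ {y} → y ≼ y) (≼-trans : ∀ {x y z} → x ≼ y → y ≼ z → x ≼ z)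
  (countable : Countable Y)
  (em₀ : ExcludedMiddle 0ℓ) (em₁ : ExcludedMiddle (Level.suc 0ℓ)) where
  open Order _≼_
  open SigmaAlgebra ScottOpen em₀

  Borel∞ : Subset∞ → Set₁
  Borel∞ = SigmaGen ScottOpen

  ↓_ : Y → Subset
  ↓ y = λ w → w ≼ y

  OutsideDown : Y → Subset∞
  OutsideDown y z = ¬ (z ≼∞ inj₁ y)

  outsideDown-scottOpen : ∀ y → ScottOpen (OutsideDown y)
  outsideDown-scottOpen y = (λ {x} {x'} → upward {x} {x'}) , inaccessible
    where
    upward : ∀ {x x'} → x ≼∞ x' → OutsideDown y x → OutsideDown y x'
    upward {inj₁ _} {inj₁ _} x≼x' x∉ x'≼y = x∉ (≼-trans x≼x' x'≼y)
    upward {inj₂ _} {inj₁ _} ()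
    upward {_}      {inj₂ _} _ _ ()
    -- If D missed OutsideDown y, then y would bound D and so s ≼∞ y.
    inaccessible : ∀ D → Directed D → ∀ s → IsSup D s → OutsideDown y s →
                   ∃ λ d → D d × OutsideDown y d
    inaccessible D _ s (_ , least) s∉ with em₁ {∃ λ d → D d × OutsideDown y d}
    ... | yes hit = hit
    ... | no miss = ⊥-elim (s∉ (least (inj₁ y) λ d d∈D → dne em₀ (λ d∉ → miss (d , d∈D , d∉))))

  down-borel : ∀ y → Borel∞ (embed (↓ y))
  down-borel y = ext (compl (gen (outsideDown-scottOpen y))) complement
    where
    complement : ∀ z → (¬ OutsideDown y z) ⇔ embed (↓ y) z
    complement (inj₁ _) = dne em₀ , λ z≼y z∉ → z∉ z≼y
    complement (inj₂ _) = (λ ¬¬⊥ → ¬¬⊥ λ ()) , λ ()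

  carrier-borel : Borel∞ (embed (λ _ → ⊤))
  carrier-borel = ext (Σ-⋃ countable (λ _ → ⊤) (λ y → embed (↓ y)) down-borel) covered
    where
    covered : ∀ z → (Σ Y λ y → ⊤ × embed (↓ y) z) ⇔ embed (λ _ → ⊤) z
    covered (inj₁ z) = (λ _ → tt) , λ _ → z , tt , ≼-refl
    covered (inj₂ _) = (λ { (_ , _ , ()) }) , λ ()

  -- An upward closed S is Y minus the union of ↓w over w ∉ S.
  upClosed-borel : ∀ S → UpClosed S → Borel∞ (embed S)
  upClosed-borel S up =
    ext (Σ-∩ carrier-borel (compl (Σ-⋃ countable (λ w → ¬ S w) (λ w → embed (↓ w)) down-borel)))
        characterisation
    where
    characterisation : ∀ z → (embed (λ _ → ⊤) z × ¬ (Σ Y λ w → ¬ S w × embed (↓ w) z)) ⇔ embed S z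
    characterisation (inj₁ z) =
        (λ { (_ , no-w) → dne em₀ λ z∉S → no-w (z , z∉S , ≼-refl) })
      , λ z∈S → tt , λ { (w , w∉S , z≼w) → w∉S (up z≼w z∈S) }
    characterisation (inj₂ _) = (λ { (() , _) }) , λ ()

  -- Induction on the generation of Σ_Y; complements are taken relative to Y.
  borelInclusion : BorelInclusion _≼_
  borelInclusion S (gen up) = upClosed-borel S up
  borelInclusion _ whole = carrier-borel
  borelInclusion _ (compl {S} gS) =
    ext (Σ-∩ carrier-borel (compl (borelInclusion S gS))) relativeComplement
    where
    relativeComplement : ∀ z → (embed (λ _ → ⊤) z × ¬ embed S z) ⇔ embed (λ y → ¬ S y) z
    relativeComplement (inj₁ _) = proj₂ , λ ¬s → tt , ¬s
    relativeComplement (inj₂ _) = (λ { (() , _) }) , λ ()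
  borelInclusion _ (union F gF) = ext (union (λ n → embed (F n)) (λ n → borelInclusion (F n) (gF n))) commute
    where
    commute : ∀ z → (Σ ℕ λ n → embed (F n) z) ⇔ embed (λ y → Σ ℕ λ n → F n y) z
    commute (inj₁ _) = (λ u → u) , λ u → u
    commute (inj₂ _) = (λ { (_ , ()) }) , λ ()
  borelInclusion _ (ext {S} {T} gS S⇔T) = ext (borelInclusion S gS) embed-⇔
    where
    embed-⇔ : ∀ z → embed S z ⇔ embed T z
    embed-⇔ (inj₁ y) = S⇔T y
    embed-⇔ (inj₂ _) = (λ ()) , λ ()

countable-injection : {T U : Set} (f : T → U) → Injective _≡_ _≡_ f → Countable U → Countable T
countable-injection f f-inj (code , code-inj) = (λ t → code (f t)) , λ e → f-inj (code-inj e)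

-- Lists of naturals are countable: n ∷ ns is coded in binary as n digits
-- 2[1+_] followed by one digit 1+[2_] in front of the code of ns.
mutual
  listCode : List ℕ → ℕᵇ
  listCode []       = 0ᵇ
  listCode (n ∷ ns) = consCode n ns

  consCode : ℕ → List ℕ → ℕᵇ
  consCode zero    ns = 1+[2 listCode ns ]
  consCode (suc n) ns = 2[1+ consCode n ns ]

mutual
  listCode-injective : ∀ ns ms → listCode ns ≡ listCode ms → ns ≡ ms
  listCode-injective []       []         _ = refl
  listCode-injective []       (zero ∷ _)  ()
  listCode-injective []       (suc _ ∷ _) ()
  listCode-injective (zero ∷ _)  [] ()
  listCode-injective (suc _ ∷ _) [] ()
  listCode-injective (n ∷ ns) (m ∷ ms) e = cong₂ _∷_ (proj₁ same) (proj₂ same)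
    where same = consCode-injective n m ns ms e

  consCode-injective : ∀ n m ns ms → consCode n ns ≡ consCode m ms → n ≡ m × ns ≡ ms
  consCode-injective zero    zero    ns ms e = refl , listCode-injective ns ms (1+[2_]-injective e)
  consCode-injective (suc n) (suc m) ns ms e =
    let n≡m , ns≡ms = consCode-injective n m ns ms (2[1+_]-injective e) in cong suc n≡m , ns≡ms
  consCode-injective zero    (suc _) _ _ ()
  consCode-injective (suc _) zero    _ _ ()

countable-List-ℕ : Countable (List ℕ)
countable-List-ℕ = (λ ns → toℕᵇ (listCode ns)) , λ e → listCode-injective _ _ (toℕ-injective e)

countable-≟ : {T : Set} → Countable T → (x y : T) → Dec (x ≡ y)
countable-≟ (code , code-inj) x y = map′ code-inj (cong code) (code x ≟ code y)

module Paths {A X : Set} (countableA : Countable A) (countableX : Countable X) where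
  codeA = proj₁ countableA
  codeX = proj₁ countableX

  codeAτ : Maybe A → ℕ
  codeAτ nothing  = zero
  codeAτ (just a) = suc (codeA a)

  codeAτ-injective : ∀ {a b} → codeAτ a ≡ codeAτ b → a ≡ b
  codeAτ-injective {nothing} {nothing} _ = refl
  codeAτ-injective {just _}  {just _}  e = cong just (proj₂ countableA (suc-injective e))
  codeAτ-injective {nothing} {just _}  ()
  codeAτ-injective {just _}  {nothing} ()

  flattenSteps : List (Aτ A X × X) → List ℕ
  flattenSteps []            = []
  flattenSteps ((a , y) ∷ s) = codeAτ a ∷ codeX y ∷ flattenSteps s

  flattenSteps-injective : ∀ s t → flattenSteps s ≡ flattenSteps t → s ≡ t
  flattenSteps-injective []      []      _ = refl
  flattenSteps-injective []      (_ ∷ _) ()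
  flattenSteps-injective (_ ∷ _) []      ()
  flattenSteps-injective ((a , y) ∷ s) ((b , z) ∷ t) e =
    let a≡b , e′ = ∷-injective e
        y≡z , s≡t = ∷-injective e′
    in cong₂ _∷_ (cong₂ _,_ (codeAτ-injective a≡b) (proj₂ countableX y≡z))
                 (flattenSteps-injective s t s≡t)

  flatten : Path A X → List ℕ
  flatten (mkPath x s) = codeX x ∷ flattenSteps s

  flatten-injective : Injective _≡_ _≡_ flatten
  flatten-injective {mkPath x s} {mkPath y t} e
    with proj₂ countableX (proj₁ (∷-injective e)) | flattenSteps-injective s t (proj₂ (∷-injective e))
  ... | refl | refl = refl

  countable-Path : Countable (Path A X)
  countable-Path = countable-injection flatten flatten-injective countable-List-ℕ

  ⪯-refl : ∀ {p} → _⪯_ A X p p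
  ⪯-refl _ _ at = at

  ⪯-trans : ∀ {p q r} → _⪯_ A X p q → _⪯_ A X q r → _⪯_ A X p r
  ⪯-trans p⪯q q⪯r ρ v at = q⪯r ρ v (p⪯q ρ v at)

  -- The stutter-removed step list exists (equality on X is decidable) ...
  stSteps : ∀ x s → Σ (List (Aτ A X × X)) (StS A X x s)
  stSteps x [] = [] , nil
  stSteps x ((just a , y) ∷ s) = let s′ , r = stSteps y s in _ , vis r
  stSteps x ((nothing , y) ∷ s) with countable-≟ countableX y x
  ... | yes refl = let s′ , r = stSteps x s in s′ , stut r
  ... | no y≢x   = let s′ , r = stSteps y s in _ , tau y≢x r

  stSteps-unique : ∀ {x s s₁ s₂} → StS A X x s s₁ → StS A X x s s₂ → s₁ ≡ s₂
  stSteps-unique nil       nil       = refl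
  stSteps-unique (vis r₁)  (vis r₂)  = cong (_ ∷_) (stSteps-unique r₁ r₂)
  stSteps-unique (stut r₁) (stut r₂) = stSteps-unique r₁ r₂
  stSteps-unique (tau _ r₁) (tau _ r₂) = cong (_ ∷_) (stSteps-unique r₁ r₂)
  stSteps-unique (stut _)  (tau x≢x _) = ⊥-elim (x≢x refl)
  stSteps-unique (tau x≢x _) (stut _)  = ⊥-elim (x≢x refl)

  st : ∀ p → Σ (Path A X) (St A X p)
  st (mkPath x s) = mkPath x (proj₁ (stSteps x s)) , refl , proj₂ (stSteps x s)

  st-unique : ∀ {p q₁ q₂} → St A X p q₁ → St A X p q₂ → q₁ ≡ q₂
  st-unique {q₁ = mkPath _ _} {q₂ = mkPath _ _} (refl , r₁) (refl , r₂)
    with stSteps-unique r₁ r₂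
  ... | refl = refl

  -- Path_∼(X) is a preorder: reflexivity by uniqueness of st, transitivity
  -- by comparing both sides with st(q).
  ⪯∼-refl : ∀ {p} → _⪯∼_ A X p p
  ⪯∼-refl {p} q₁ q₂ s₁ s₂ rewrite st-unique {p} {q₁} {q₂} s₁ s₂ = ⪯-refl {q₂}

  ⪯∼-trans : ∀ {p q r} → _⪯∼_ A X p q → _⪯∼_ A X q r → _⪯∼_ A X p r
  ⪯∼-trans {q = q} p⪯∼q q⪯∼r p′ r′ sp sr =
    let q′ , sq = st q in ⪯-trans {p′} {q′} {r′} (p⪯∼q p′ q′ sp sq) (q⪯∼r q′ r′ sq sr)

theorem39 : ExcludedMiddle 0ℓ → ExcludedMiddle (Level.suc 0ℓ) →
    {A X : Set} → Countable A → Countable X →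
    BorelInclusion (_⪯_ A X) × BorelInclusion (_⪯∼_ A X)
theorem39 em₀ em₁ {A} {X} countableA countableX =
    CountablePreorder.borelInclusion (_⪯_ A X)
      (λ {p} → ⪯-refl {p}) (λ {p} {q} {r} → ⪯-trans {p} {q} {r}) countable-Path em₀ em₁
  , CountablePreorder.borelInclusion (_⪯∼_ A X)
      (λ {p} → ⪯∼-refl {p}) (λ {p} {q} {r} → ⪯∼-trans {p} {q} {r}) countable-Path em₀ em₁
  where open Paths countableA countableX
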